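{- Let $w,k,b$ be positive integers with $k\le w$. If $B$ is a block of length $k$ with digits in $\{0,1,\dots,b\}$, then $$N(B,P_{b,w})\le w\,(2^b-b)^{g_b(B)}\,2^{b(w-k)}+(k-1)(b+1)^w.$$
   Context: For a positive integer $b$, define $\nu_b(j)=2^{ -b}$ for $0\le j\le b-1$, $\nu_b(b)=(2^b-b)/2^b$, $\nu_b(j)=0$ for $j>b$, and $\nu_b(c_1,\dots,c_k)=\prod_j\nu_b(c_j)$. Let $P_1,\dots,P_{(b+1)^w}$ be all blocks of length $w$ with digits in $\{0,\dots,b\}$, in lexicographic order, and let $P_{b,w}$ be the block obtained by concatenating $2^{bw}\nu_b(P_1)$ copies of $P_1$, then $2^{bw}\nu_b(P_2)$ copies of $P_2$, and so on up to $P_{(b+1)^w}$ (multiplicities $(2^b-b)^{g}$, $g$ = number of digits equal to $b$). For a block $B=(c_1,\dots,c_k)$ with digits in $\{0,\dots,b\}$, $g_b(B)=|\{j:c_j=b\}|$. For blocks $B,y$, $N(B,y)$ is the number of positions at which $B$ occurs as a contiguous subblock of $y$ (occurrences may overlap). -}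

module Defs where

open import Data.Nat using (ℕ; zero; suc; _+_; _*_; _∸_; _^_)
open import Data.Fin using (Fin; toℕ)
open import Data.List using (List; []; _∷_; map; concatMap; replicate; concat; length; drop; allFin)
open import Data.Bool using (Bool; true; false; _∧_)
open import Relation.Nullary.Decidable using (⌊_⌋)
open import Data.Nat using (_≟_)
open import Relation.Nullary using (yes; no)

Block : ℕ → Set
Block b = List (Fin (suc b))

allBlocks : (b w : ℕ) → List (Block b)
allBlocks b zero = [] ∷ []
allBlocks b (suc w) = concatMap (λ d → map (d ∷_) (allBlocks b w)) (allFin (suc b))

g : (b : ℕ) → Block b → ℕ
g b [] = 0
g b (c ∷ cs) with toℕ c ≟ b
... | yes _ = suc (g b cs)
... | no _ = g b cs

-- multiplicity 2^{bw} ν_b(P) = (2^b - b)^{g_b(P)}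
mult : (b : ℕ) → Block b → ℕ
mult b P = (2 ^ b ∸ b) ^ g b P

P : (b w : ℕ) → Block b
P b w = concatMap (λ Q → concat (replicate (mult b Q) Q)) (allBlocks b w)

isPrefix : {b : ℕ} → Block b → Block b → Bool
isPrefix [] _ = true
isPrefix (_ ∷ _) [] = false
isPrefix (c ∷ cs) (d ∷ ds) = ⌊ toℕ c ≟ toℕ d ⌋ ∧ isPrefix cs ds

-- number of positions i (0 ≤ i < |y|) at which B occurs in y (overlaps allowed)
countFrom : {b : ℕ} → Block b → Block b → ℕ
countFrom B [] = 0
countFrom B (d ∷ ds) with isPrefix B (d ∷ ds)
... | true = suc (countFrom B ds)
... | false = countFrom B ds

N : {b : ℕ} → Block b → Block b → ℕ
N B y = countFrom B y

-- P_{b,w} is the concatenation of runs Q Q ⋯ Q, one run of mult Q copies for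
-- each block Q of length w ≥ k. An occurrence of B starting in a run, except
-- possibly one starting in its last k − 1 positions, lies inside two consecutive
-- copies of Q and is therefore a cyclic occurrence of B in Q; hence
--   N(B, P_{b,w}) ≤ Σ_Q mult Q · countCyclic B Q + (b+1)^w (k − 1).
-- The weighted sum Σ_Q mult Q · φ Q is integration against a product measure of
-- total mass 2^{bw}. This measure is invariant under cyclic rotation of Q, and
-- the blocks beginning with B have mass mult B · 2^{b(w−k)}; so each of the w
-- cyclic positions contributes exactly mult B · 2^{b(w−k)}.
module Submission where

open import Defs
open import Data.Nat using (ℕ; zero; suc; _+_; _*_; _∸_; _^_; _≤_; _<_; _≟_; z≤n; s≤s)
open import Data.Nat.Properties
open import Data.Nat.ListAction using (sum)
open import Data.Nat.ListAction.Properties using (sum-++)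
open import Data.Fin using (Fin; toℕ; inject₁; fromℕ) renaming (zero to fzero; suc to fsuc)
open import Data.Fin.Properties using (toℕ<n; toℕ-inject₁; toℕ-fromℕ)
open import Data.List using (List; []; _∷_; _++_; [_]; map; concat; concatMap; replicate; length; take; drop; tabulate; allFin)
open import Data.List.Properties
  using (++-assoc; ++-identityʳ; length-++; length-++-comm; length-++-≤ʳ; length-map; length-tabulate; map-++; map-∘; map-cong; map-tabulate; take++drop≡id; drop-all)
open import Data.List.Relation.Unary.All as All using (All; []; _∷_)
open import Data.List.Relation.Unary.All.Properties using (concat⁺; map⁺; tabulate⁺; gmap⁺)
open import Data.Bool using (Bool; true; false; _∧_)
open import Data.Empty using (⊥-elim)
open import Function using (_∘_)
open import Relation.Nullary using (yes; no)
open import Relation.Nullary.Decidable using (⌊_⌋)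
open import Relation.Binary.PropositionalEquality using (_≡_; refl; sym; trans; cong; cong₂; subst; module ≡-Reasoning)
open import Algebra.Properties.Semiring.Sum +-*-semiring
  using (sum-syntax; sum-cong-≗; sum-init-last; sum-replicate-zero; ∑-distrib-+; *-distribˡ-sum; *-distribʳ-sum)
open import Algebra.Properties.CommutativeSemigroup +-commutativeSemigroup using (interchange)
open import Algebra.Properties.CommutativeSemigroup *-commutativeSemigroup using () renaming (x∙yz≈y∙xz to x*[y*z]≡y*[x*z])

open ≡-Reasoning

𝟙 : Bool → ℕ
𝟙 true = 1
𝟙 false = 0

𝟙-∧ : ∀ x y → 𝟙 (x ∧ y) ≡ 𝟙 x * 𝟙 y
𝟙-∧ true y = sym (+-identityʳ (𝟙 y))
𝟙-∧ false y = refl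

𝟙≤1 : ∀ x → 𝟙 x ≤ 1
𝟙≤1 true = ≤-refl
𝟙≤1 false = z≤n

⌊suc≟suc⌋ : ∀ m n → ⌊ suc m ≟ suc n ⌋ ≡ ⌊ m ≟ n ⌋
⌊suc≟suc⌋ m n with m ≟ n | suc m ≟ suc n
... | yes _ | yes _ = refl
... | no _ | no _ = refl
... | yes m≡n | no sm≢sn = ⊥-elim (sm≢sn (cong suc m≡n))
... | no m≢n | yes sm≡sn = ⊥-elim (m≢n (suc-injective sm≡sn))

n<2^n : ∀ n → n < 2 ^ n
n<2^n zero = s≤s z≤n
n<2^n (suc n) = +-mono-≤-< (m^n>0 2 n) (≤-trans (n<2^n n) (m≤m+n _ 0))

∑-ones : ∀ n → ∑[ i < n ] 1 ≡ n
∑-ones zero = refl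
∑-ones (suc n) = cong suc (∑-ones n)

∑-δ : ∀ {n} (c : Fin n) (f : Fin n → ℕ) → ∑[ d < n ] (𝟙 ⌊ toℕ c ≟ toℕ d ⌋ * f d) ≡ f c
∑-δ {suc n} fzero f = begin
  f fzero + 0 + ∑[ d < n ] 0 ≡⟨ cong (f fzero + 0 +_) (sum-replicate-zero n) ⟩
  f fzero + 0 + 0            ≡⟨ +-identityʳ _ ⟩
  f fzero + 0                ≡⟨ +-identityʳ _ ⟩
  f fzero                    ∎
∑-δ {suc n} (fsuc c) f = begin
  ∑[ d < n ] (𝟙 ⌊ suc (toℕ c) ≟ suc (toℕ d) ⌋ * f (fsuc d))
    ≡⟨ sum-cong-≗ (λ d → cong (λ x → 𝟙 x * f (fsuc d)) (⌊suc≟suc⌋ (toℕ c) (toℕ d))) ⟩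
  ∑[ d < n ] (𝟙 ⌊ toℕ c ≟ toℕ d ⌋ * f (fsuc d))
    ≡⟨ ∑-δ c (f ∘ fsuc) ⟩
  f (fsuc c) ∎

module _ {A : Set} where

  sum-map-*ˡ : ∀ c (f : A → ℕ) xs → sum (map (λ x → c * f x) xs) ≡ c * sum (map f xs)
  sum-map-*ˡ c f [] = sym (*-zeroʳ c)
  sum-map-*ˡ c f (x ∷ xs) = begin
    c * f x + sum (map (λ x → c * f x) xs) ≡⟨ cong (c * f x +_) (sum-map-*ˡ c f xs) ⟩
    c * f x + c * sum (map f xs)           ≡⟨ *-distribˡ-+ c (f x) _ ⟨
    c * (f x + sum (map f xs))             ∎

  sum-map-concatMap : ∀ {B : Set} (h : B → ℕ) (f : A → List B) xs →
    sum (map h (concatMap f xs)) ≡ sum (map (λ x → sum (map h (f x))) xs)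
  sum-map-concatMap h f [] = refl
  sum-map-concatMap h f (x ∷ xs) = begin
    sum (map h (f x ++ concatMap f xs))                  ≡⟨ cong sum (map-++ h (f x) _) ⟩
    sum (map h (f x) ++ map h (concatMap f xs))          ≡⟨ sum-++ (map h (f x)) _ ⟩
    sum (map h (f x)) + sum (map h (concatMap f xs))     ≡⟨ cong (sum (map h (f x)) +_) (sum-map-concatMap h f xs) ⟩
    sum (map h (f x)) + sum (map (λ x → sum (map h (f x))) xs) ∎

  length-concatMap-const : ∀ {B : Set} (f : A → List B) c xs → (∀ x → length (f x) ≡ c) →
    length (concatMap f xs) ≡ length xs * c
  length-concatMap-const f c [] _ = refl
  length-concatMap-const f c (x ∷ xs) h = begin
    length (f x ++ concatMap f xs)         ≡⟨ length-++ (f x) ⟩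
    length (f x) + length (concatMap f xs) ≡⟨ cong₂ _+_ (h x) (length-concatMap-const f c xs h) ⟩
    c + length xs * c                      ∎

  take-length-++ : (xs ys : List A) → take (length xs) (xs ++ ys) ≡ xs
  take-length-++ [] ys = refl
  take-length-++ (x ∷ xs) ys = cong (x ∷_) (take-length-++ xs ys)

  drop-length-++ : (xs ys : List A) → drop (length xs) (xs ++ ys) ≡ ys
  drop-length-++ [] ys = refl
  drop-length-++ (x ∷ xs) ys = drop-length-++ xs ys

  rotate : ℕ → List A → List A
  rotate j xs = drop j xs ++ take j xs

  length-rotate : ∀ j (xs : List A) → length (rotate j xs) ≡ length xs
  length-rotate j xs = trans (length-++-comm (drop j xs) (take j xs)) (cong length (take++drop≡id j xs))

  rotate-++ : (xs ys : List A) → rotate (length xs) (xs ++ ys) ≡ ys ++ xs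
  rotate-++ xs ys = cong₂ _++_ (drop-length-++ xs ys) (take-length-++ xs ys)

sum-map-allFin : ∀ {n} (f : Fin n → ℕ) → sum (map f (allFin n)) ≡ ∑[ i < n ] f i
sum-map-allFin {n} f = trans (cong sum (map-tabulate (λ i → i) f)) (sum-tabulate f)
  where
  sum-tabulate : ∀ {m} (g : Fin m → ℕ) → sum (tabulate g) ≡ ∑[ i < m ] g i
  sum-tabulate {zero} g = refl
  sum-tabulate {suc m} g = cong (g fzero +_) (sum-tabulate (g ∘ fsuc))

module _ {b : ℕ} where

  isPrefix-++ʳ : (B xs ys : Block b) → length B ≤ length xs → isPrefix B (xs ++ ys) ≡ isPrefix B xs
  isPrefix-++ʳ [] xs ys _ = refl
  isPrefix-++ʳ (c ∷ B) (x ∷ xs) ys (s≤s p) = cong (⌊ toℕ c ≟ toℕ x ⌋ ∧_) (isPrefix-++ʳ B xs ys p)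

  countStartingIn : Block b → Block b → Block b → ℕ
  countStartingIn B [] y = 0
  countStartingIn B (x ∷ xs) y = 𝟙 (isPrefix B (x ∷ xs ++ y)) + countStartingIn B xs y

  countCyclic : Block b → Block b → ℕ
  countCyclic B Q = countStartingIn B Q Q

  countFrom-++ : (B xs y : Block b) → countFrom B (xs ++ y) ≡ countStartingIn B xs y + countFrom B y
  countFrom-++ B [] y = refl
  countFrom-++ B (x ∷ xs) y with isPrefix B (x ∷ (xs ++ y))
  ... | true = cong suc (countFrom-++ B xs y)
  ... | false = countFrom-++ B xs y

  countStartingIn-++ : (B xs ys z : Block b) →
    countStartingIn B (xs ++ ys) z ≡ countStartingIn B xs (ys ++ z) + countStartingIn B ys z
  countStartingIn-++ B [] ys z = refl
  countStartingIn-++ B (x ∷ xs) ys z = begin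
    𝟙 (isPrefix B (x ∷ (xs ++ ys) ++ z)) + countStartingIn B (xs ++ ys) z
      ≡⟨ cong₂ _+_ (cong (λ l → 𝟙 (isPrefix B (x ∷ l))) (++-assoc xs ys z)) (countStartingIn-++ B xs ys z) ⟩
    𝟙 (isPrefix B (x ∷ xs ++ ys ++ z)) + (countStartingIn B xs (ys ++ z) + countStartingIn B ys z)
      ≡⟨ +-assoc (𝟙 (isPrefix B (x ∷ xs ++ ys ++ z))) (countStartingIn B xs (ys ++ z)) _ ⟨
    𝟙 (isPrefix B (x ∷ xs ++ ys ++ z)) + countStartingIn B xs (ys ++ z) + countStartingIn B ys z ∎

  countStartingIn-≤-length : (B xs y : Block b) → countStartingIn B xs y ≤ length xs
  countStartingIn-≤-length B [] y = z≤n
  countStartingIn-≤-length B (x ∷ xs) y = +-mono-≤ (𝟙≤1 _) (countStartingIn-≤-length B xs y)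

  countStartingIn-++ʳ : (B xs ys z : Block b) → length B ≤ length ys →
    countStartingIn B xs (ys ++ z) ≡ countStartingIn B xs ys
  countStartingIn-++ʳ B [] ys z _ = refl
  countStartingIn-++ʳ B (x ∷ xs) ys z k≤ys = cong₂ _+_ (cong 𝟙 prefix) (countStartingIn-++ʳ B xs ys z k≤ys)
    where
    prefix : isPrefix B (x ∷ xs ++ ys ++ z) ≡ isPrefix B (x ∷ xs ++ ys)
    prefix = trans (cong (isPrefix B) (sym (++-assoc (x ∷ xs) ys z)))
                   (isPrefix-++ʳ B (x ∷ xs ++ ys) z (≤-trans k≤ys (length-++-≤ʳ ys {x ∷ xs})))

  -- Only occurrences starting in the last length B ∸ 1 positions of xs can see y.
  countStartingIn-boundary : (B xs y z : Block b) → countStartingIn B xs y ≤ countStartingIn B xs z + (length B ∸ 1)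
  countStartingIn-boundary B [] y z = z≤n
  countStartingIn-boundary B (x ∷ xs) y z with length B ≤? length (x ∷ xs)
  ... | yes k≤xs rewrite isPrefix-++ʳ B (x ∷ xs) y k≤xs | isPrefix-++ʳ B (x ∷ xs) z k≤xs =
        ≤-trans (+-monoʳ-≤ (𝟙 (isPrefix B (x ∷ xs))) (countStartingIn-boundary B xs y z))
                (≤-reflexive (sym (+-assoc (𝟙 (isPrefix B (x ∷ xs))) (countStartingIn B xs z) _)))
  ... | no k≰xs = ≤-trans (countStartingIn-≤-length B (x ∷ xs) y)
                          (≤-trans (<⇒≤pred (≰⇒> k≰xs)) (m≤n+m _ _))

  concat-replicate-++ : ∀ m (Q : Block b) → concat (replicate m Q) ++ Q ≡ Q ++ concat (replicate m Q)
  concat-replicate-++ zero Q = sym (++-identityʳ Q)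
  concat-replicate-++ (suc m) Q = begin
    (Q ++ concat (replicate m Q)) ++ Q ≡⟨ ++-assoc Q _ Q ⟩
    Q ++ (concat (replicate m Q) ++ Q) ≡⟨ cong (Q ++_) (concat-replicate-++ m Q) ⟩
    Q ++ (Q ++ concat (replicate m Q)) ∎

  countStartingIn-replicate : ∀ m (B Q : Block b) → length B ≤ length Q →
    countStartingIn B (concat (replicate m Q)) Q ≡ m * countCyclic B Q
  countStartingIn-replicate zero B Q _ = refl
  countStartingIn-replicate (suc m) B Q k≤w = begin
    countStartingIn B (Q ++ Qᵐ) Q                             ≡⟨ countStartingIn-++ B Q Qᵐ Q ⟩
    countStartingIn B Q (Qᵐ ++ Q) + countStartingIn B Qᵐ Q    ≡⟨ cong₂ _+_ first (countStartingIn-replicate m B Q k≤w) ⟩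
    countCyclic B Q + m * countCyclic B Q                     ∎
    where
    Qᵐ = concat (replicate m Q)
    first : countStartingIn B Q (Qᵐ ++ Q) ≡ countCyclic B Q
    first = trans (cong (countStartingIn B Q) (concat-replicate-++ m Q)) (countStartingIn-++ʳ B Q Q Qᵐ k≤w)

  countFrom-replicate : ∀ m (B Q r : Block b) → length B ≤ length Q →
    countFrom B (concat (replicate m Q) ++ r) ≤ m * countCyclic B Q + (length B ∸ 1) + countFrom B r
  countFrom-replicate m B Q r k≤w = ≤-trans (≤-reflexive (countFrom-++ B (concat (replicate m Q)) r))
    (+-monoˡ-≤ (countFrom B r)
      (≤-trans (countStartingIn-boundary B (concat (replicate m Q)) r Q)
               (≤-reflexive (cong (_+ (length B ∸ 1)) (countStartingIn-replicate m B Q k≤w)))))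

  countFrom-runs : (B : Block b) (Qs : List (Block b)) → All (λ Q → length B ≤ length Q) Qs →
    countFrom B (concatMap (λ Q → concat (replicate (mult b Q) Q)) Qs)
      ≤ sum (map (λ Q → mult b Q * countCyclic B Q) Qs) + length Qs * (length B ∸ 1)
  countFrom-runs B [] [] = z≤n
  countFrom-runs B (Q ∷ Qs) (k≤w ∷ k≤ws) =
    ≤-trans (countFrom-replicate (mult b Q) B Q _ k≤w)
      (≤-trans (+-monoʳ-≤ _ (countFrom-runs B Qs k≤ws))
        (≤-reflexive (interchange (mult b Q * countCyclic B Q) (length B ∸ 1) _ _)))

  g-∷ : ∀ d (Q : Block b) → g b (d ∷ Q) ≡ g b [ d ] + g b Q
  g-∷ d Q with toℕ d ≟ b
  ... | yes _ = refl
  ... | no _ = refl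

  g-++ : (P Q : Block b) → g b (P ++ Q) ≡ g b P + g b Q
  g-++ [] Q = refl
  g-++ (d ∷ P) Q = begin
    g b (d ∷ P ++ Q)            ≡⟨ g-∷ d (P ++ Q) ⟩
    g b [ d ] + g b (P ++ Q)    ≡⟨ cong (g b [ d ] +_) (g-++ P Q) ⟩
    g b [ d ] + (g b P + g b Q) ≡⟨ +-assoc (g b [ d ]) _ _ ⟨
    g b [ d ] + g b P + g b Q   ≡⟨ cong (_+ g b Q) (g-∷ d P) ⟨
    g b (d ∷ P) + g b Q         ∎

  mult-++ : (P Q : Block b) → mult b (P ++ Q) ≡ mult b P * mult b Q
  mult-++ P Q = trans (cong ((2 ^ b ∸ b) ^_) (g-++ P Q)) (^-distribˡ-+-* _ (g b P) (g b Q))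

  mult-digit-< : (d : Fin (suc b)) → toℕ d < b → mult b [ d ] ≡ 1
  mult-digit-< d d<b with toℕ d ≟ b
  ... | yes d≡b = ⊥-elim (<-irrefl d≡b d<b)
  ... | no _ = refl

  mult-digit-b : (d : Fin (suc b)) → toℕ d ≡ b → mult b [ d ] ≡ 2 ^ b ∸ b
  mult-digit-b d d≡b with toℕ d ≟ b
  ... | yes _ = *-identityʳ _
  ... | no d≢b = ⊥-elim (d≢b d≡b)

  ∑-mult-digit : ∑[ d < suc b ] mult b [ d ] ≡ 2 ^ b
  ∑-mult-digit = begin
    ∑[ d < suc b ] mult b [ d ]
      ≡⟨ sum-init-last (λ d → mult b [ d ]) ⟩
    ∑[ i < b ] mult b [ inject₁ i ] + mult b [ fromℕ b ]
      ≡⟨ cong₂ _+_ (sum-cong-≗ (λ i → mult-digit-< (inject₁ i) (subst (_< b) (sym (toℕ-inject₁ i)) (toℕ<n i))))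
                   (mult-digit-b (fromℕ b) (toℕ-fromℕ b)) ⟩
    ∑[ i < b ] 1 + (2 ^ b ∸ b)
      ≡⟨ cong (_+ (2 ^ b ∸ b)) (∑-ones b) ⟩
    b + (2 ^ b ∸ b)
      ≡⟨ m+[n∸m]≡n (<⇒≤ (n<2^n b)) ⟩
    2 ^ b ∎

  -- 2^{bw} times the ν_b-expectation of φ on blocks of length w
  ∫ : ℕ → (Block b → ℕ) → ℕ
  ∫ zero φ = φ []
  ∫ (suc w) φ = ∑[ d < suc b ] (mult b [ d ] * ∫ w (λ Q → φ (d ∷ Q)))

  ∫-cong : ∀ w {φ ψ : Block b → ℕ} → (∀ Q → length Q ≡ w → φ Q ≡ ψ Q) → ∫ w φ ≡ ∫ w ψ
  ∫-cong zero h = h [] refl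
  ∫-cong (suc w) h = sum-cong-≗ (λ d → cong (mult b [ d ] *_) (∫-cong w (λ Q e → h (d ∷ Q) (cong suc e))))

  ∫-+ : ∀ w (φ ψ : Block b → ℕ) → ∫ w (λ Q → φ Q + ψ Q) ≡ ∫ w φ + ∫ w ψ
  ∫-+ zero φ ψ = refl
  ∫-+ (suc w) φ ψ = trans (sum-cong-≗ digit) (∑-distrib-+ (term φ) (term ψ))
    where
    term : (Block b → ℕ) → Fin (suc b) → ℕ
    term χ d = mult b [ d ] * ∫ w (χ ∘ (d ∷_))
    digit : ∀ d → mult b [ d ] * ∫ w (λ Q → φ (d ∷ Q) + ψ (d ∷ Q)) ≡ term φ d + term ψ d
    digit d = trans (cong (mult b [ d ] *_) (∫-+ w (φ ∘ (d ∷_)) (ψ ∘ (d ∷_)))) (*-distribˡ-+ (mult b [ d ]) _ _)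

  ∫-*ˡ : ∀ w c (φ : Block b → ℕ) → ∫ w (λ Q → c * φ Q) ≡ c * ∫ w φ
  ∫-*ˡ zero c φ = refl
  ∫-*ˡ (suc w) c φ = trans (sum-cong-≗ digit) (sym (*-distribˡ-sum c term))
    where
    term : Fin (suc b) → ℕ
    term d = mult b [ d ] * ∫ w (φ ∘ (d ∷_))
    digit : ∀ d → mult b [ d ] * ∫ w (λ Q → c * φ (d ∷ Q)) ≡ c * term d
    digit d = trans (cong (mult b [ d ] *_) (∫-*ˡ w c (φ ∘ (d ∷_)))) (x*[y*z]≡y*[x*z] (mult b [ d ]) c _)

  ∫-*ʳ : ∀ w c (φ : Block b → ℕ) → ∫ w (λ Q → φ Q * c) ≡ ∫ w φ * c
  ∫-*ʳ w c φ = trans (∫-cong w (λ Q _ → *-comm (φ Q) c)) (trans (∫-*ˡ w c φ) (*-comm c _))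

  ∫-∑ : ∀ w {n} (f : Fin n → Block b → ℕ) → ∫ w (λ Q → ∑[ i < n ] f i Q) ≡ ∑[ i < n ] ∫ w (f i)
  ∫-∑ w {zero} f = ∫-*ˡ w 0 (λ _ → 0)
  ∫-∑ w {suc n} f = trans (∫-+ w (f fzero) _) (cong (∫ w (f fzero) +_) (∫-∑ w (f ∘ fsuc)))

  ∫-one : ∀ w → ∫ w (λ _ → 1) ≡ 2 ^ (b * w)
  ∫-one zero = cong (2 ^_) (sym (*-zeroʳ b))
  ∫-one (suc w) = begin
    ∑[ d < suc b ] (mult b [ d ] * ∫ w (λ _ → 1))  ≡⟨ sum-cong-≗ (λ d → cong (mult b [ d ] *_) (∫-one w)) ⟩
    ∑[ d < suc b ] (mult b [ d ] * 2 ^ (b * w))    ≡⟨ *-distribʳ-sum (2 ^ (b * w)) (λ d → mult b [ d ]) ⟨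
    (∑[ d < suc b ] mult b [ d ]) * 2 ^ (b * w)    ≡⟨ cong (_* 2 ^ (b * w)) ∑-mult-digit ⟩
    2 ^ b * 2 ^ (b * w)                            ≡⟨ ^-distribˡ-+-* 2 b (b * w) ⟨
    2 ^ (b + b * w)                                ≡⟨ cong (2 ^_) (*-suc b w) ⟨
    2 ^ (b * suc w)                                ∎

  ∫-const : ∀ w c → ∫ w (λ _ → c) ≡ c * 2 ^ (b * w)
  ∫-const w c = begin
    ∫ w (λ _ → c)     ≡⟨ ∫-cong w (λ _ _ → *-identityʳ c) ⟨
    ∫ w (λ _ → c * 1) ≡⟨ ∫-*ˡ w c (λ _ → 1) ⟩
    c * ∫ w (λ _ → 1) ≡⟨ cong (c *_) (∫-one w) ⟩
    c * 2 ^ (b * w)   ∎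

  ∫-++ : ∀ m n (φ : Block b → ℕ) → ∫ (m + n) φ ≡ ∫ m (λ X → ∫ n (λ Y → φ (X ++ Y)))
  ∫-++ zero n φ = refl
  ∫-++ (suc m) n φ = sum-cong-≗ (λ d → cong (mult b [ d ] *_) (∫-++ m n (φ ∘ (d ∷_))))

  ∫-swap : ∀ m n (F : Block b → Block b → ℕ) → ∫ m (λ X → ∫ n (F X)) ≡ ∫ n (λ Y → ∫ m (λ X → F X Y))
  ∫-swap zero n F = refl
  ∫-swap (suc m) n F = begin
    ∑[ d < suc b ] (mult b [ d ] * ∫ m (λ X → ∫ n (F (d ∷ X))))
      ≡⟨ sum-cong-≗ (λ d → cong (mult b [ d ] *_) (∫-swap m n (F ∘ (d ∷_)))) ⟩
    ∑[ d < suc b ] (mult b [ d ] * ∫ n (λ Y → ∫ m (λ X → F (d ∷ X) Y)))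
      ≡⟨ sum-cong-≗ (λ d → ∫-*ˡ n (mult b [ d ]) (λ Y → ∫ m (λ X → F (d ∷ X) Y))) ⟨
    ∑[ d < suc b ] ∫ n (λ Y → mult b [ d ] * ∫ m (λ X → F (d ∷ X) Y))
      ≡⟨ ∫-∑ n (λ d Y → mult b [ d ] * ∫ m (λ X → F (d ∷ X) Y)) ⟨
    ∫ n (λ Y → ∑[ d < suc b ] (mult b [ d ] * ∫ m (λ X → F (d ∷ X) Y))) ∎

  ∫-isPrefix : (B : Block b) → ∫ (length B) (λ Q → 𝟙 (isPrefix B Q)) ≡ mult b B
  ∫-isPrefix [] = refl
  ∫-isPrefix (c ∷ B) = begin
    ∑[ d < suc b ] (mult b [ d ] * ∫ (length B) (λ Q → 𝟙 (δ d ∧ isPrefix B Q)))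
      ≡⟨ sum-cong-≗ (λ d → cong (mult b [ d ] *_) (digit d)) ⟩
    ∑[ d < suc b ] (mult b [ d ] * (𝟙 (δ d) * mult b B))
      ≡⟨ sum-cong-≗ (λ d → x*[y*z]≡y*[x*z] (mult b [ d ]) (𝟙 (δ d)) (mult b B)) ⟩
    ∑[ d < suc b ] (𝟙 (δ d) * (mult b [ d ] * mult b B))
      ≡⟨ ∑-δ c (λ d → mult b [ d ] * mult b B) ⟩
    mult b [ c ] * mult b B
      ≡⟨ mult-++ [ c ] B ⟨
    mult b (c ∷ B) ∎
    where
    δ : Fin (suc b) → Bool
    δ d = ⌊ toℕ c ≟ toℕ d ⌋
    digit : ∀ d → ∫ (length B) (λ Q → 𝟙 (δ d ∧ isPrefix B Q)) ≡ 𝟙 (δ d) * mult b B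
    digit d = begin
      ∫ (length B) (λ Q → 𝟙 (δ d ∧ isPrefix B Q))       ≡⟨ ∫-cong (length B) (λ Q _ → 𝟙-∧ (δ d) _) ⟩
      ∫ (length B) (λ Q → 𝟙 (δ d) * 𝟙 (isPrefix B Q)) ≡⟨ ∫-*ˡ (length B) (𝟙 (δ d)) _ ⟩
      𝟙 (δ d) * ∫ (length B) (λ Q → 𝟙 (isPrefix B Q)) ≡⟨ cong (𝟙 (δ d) *_) (∫-isPrefix B) ⟩
      𝟙 (δ d) * mult b B                              ∎

  ∫-isPrefix-+ : (B : Block b) (r : ℕ) → ∫ (length B + r) (λ Q → 𝟙 (isPrefix B Q)) ≡ mult b B * 2 ^ (b * r)
  ∫-isPrefix-+ B r = begin
    ∫ (length B + r) (λ Q → 𝟙 (isPrefix B Q))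
      ≡⟨ ∫-++ (length B) r _ ⟩
    ∫ (length B) (λ X → ∫ r (λ Y → 𝟙 (isPrefix B (X ++ Y))))
      ≡⟨ ∫-cong (length B) (λ X e → trans (∫-cong r (λ Y _ → cong 𝟙 (isPrefix-++ʳ B X Y (≤-reflexive (sym e)))))
                                          (∫-const r _)) ⟩
    ∫ (length B) (λ X → 𝟙 (isPrefix B X) * 2 ^ (b * r))
      ≡⟨ ∫-*ʳ (length B) _ _ ⟩
    ∫ (length B) (λ X → 𝟙 (isPrefix B X)) * 2 ^ (b * r)
      ≡⟨ cong (_* 2 ^ (b * r)) (∫-isPrefix B) ⟩
    mult b B * 2 ^ (b * r) ∎

  ∫-rotate : ∀ j n (ψ : Block b → ℕ) → ∫ (j + n) (λ Q → ψ (rotate j Q)) ≡ ∫ (n + j) ψ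
  ∫-rotate j n ψ = begin
    ∫ (j + n) (λ Q → ψ (rotate j Q))
      ≡⟨ ∫-++ j n _ ⟩
    ∫ j (λ X → ∫ n (λ Y → ψ (rotate j (X ++ Y))))
      ≡⟨ ∫-cong j (λ X e → ∫-cong n (λ Y _ → cong ψ (subst (λ i → rotate i (X ++ Y) ≡ Y ++ X) e (rotate-++ X Y)))) ⟩
    ∫ j (λ X → ∫ n (λ Y → ψ (Y ++ X)))
      ≡⟨ ∫-swap j n _ ⟩
    ∫ n (λ Y → ∫ j (λ X → ψ (Y ++ X)))
      ≡⟨ ∫-++ n j ψ ⟨
    ∫ (n + j) ψ ∎

  isPrefix-drop-++ : (B Q : Block b) → length B ≤ length Q → ∀ j → isPrefix B (drop j Q ++ Q) ≡ isPrefix B (rotate j Q)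
  isPrefix-drop-++ B Q k≤w j = begin
    isPrefix B (drop j Q ++ Q)                        ≡⟨ cong (λ l → isPrefix B (drop j Q ++ l)) (take++drop≡id j Q) ⟨
    isPrefix B (drop j Q ++ (take j Q ++ drop j Q))   ≡⟨ cong (isPrefix B) (++-assoc (drop j Q) (take j Q) (drop j Q)) ⟨
    isPrefix B (rotate j Q ++ drop j Q)               ≡⟨ isPrefix-++ʳ B (rotate j Q) (drop j Q) k≤rotate ⟩
    isPrefix B (rotate j Q)                           ∎
    where
    k≤rotate : length B ≤ length (rotate j Q)
    k≤rotate = ≤-trans k≤w (≤-reflexive (sym (length-rotate j Q)))

  ∫-occurrence : (B : Block b) → ∀ w j → length B ≤ w → j ≤ w →
    ∫ w (λ Q → 𝟙 (isPrefix B (drop j Q ++ Q))) ≡ mult b B * 2 ^ (b * (w ∸ length B))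
  ∫-occurrence B w j k≤w j≤w = begin
    ∫ w (λ Q → 𝟙 (isPrefix B (drop j Q ++ Q)))
      ≡⟨ ∫-cong w (λ Q e → cong 𝟙 (isPrefix-drop-++ B Q (≤-trans k≤w (≤-reflexive (sym e))) j)) ⟩
    ∫ w (λ Q → 𝟙 (isPrefix B (rotate j Q)))
      ≡⟨ cong (λ m → ∫ m (λ Q → 𝟙 (isPrefix B (rotate j Q)))) (m+[n∸m]≡n j≤w) ⟨
    ∫ (j + (w ∸ j)) (λ Q → 𝟙 (isPrefix B (rotate j Q)))
      ≡⟨ ∫-rotate j (w ∸ j) (λ Q → 𝟙 (isPrefix B Q)) ⟩
    ∫ ((w ∸ j) + j) (λ Q → 𝟙 (isPrefix B Q))
      ≡⟨ cong (λ m → ∫ m (λ Q → 𝟙 (isPrefix B Q))) (trans (m∸n+n≡m j≤w) (sym (m+[n∸m]≡n k≤w))) ⟩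
    ∫ (length B + (w ∸ length B)) (λ Q → 𝟙 (isPrefix B Q))
      ≡⟨ ∫-isPrefix-+ B (w ∸ length B) ⟩
    mult b B * 2 ^ (b * (w ∸ length B)) ∎

  countStartingIn-drop : (B xs y : Block b) → ∀ j → j < length xs →
    countStartingIn B (drop j xs) y ≡ 𝟙 (isPrefix B (drop j xs ++ y)) + countStartingIn B (drop (suc j) xs) y
  countStartingIn-drop B (x ∷ xs) y zero _ = refl
  countStartingIn-drop B (x ∷ xs) y (suc j) (s≤s j<xs) = countStartingIn-drop B xs y j j<xs

  ∫-countStartingIn-drop : (B : Block b) → ∀ w → length B ≤ w → ∀ n j → j + n ≡ w →
    ∫ w (λ Q → countStartingIn B (drop j Q) Q) ≡ n * (mult b B * 2 ^ (b * (w ∸ length B)))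
  ∫-countStartingIn-drop B w k≤w zero j j+0≡w =
    trans (∫-cong w (λ Q e → cong (λ l → countStartingIn B l Q) (drop-all j Q (≤-reflexive (trans e (sym j≡w))))))
          (∫-*ˡ w 0 (λ _ → 0))
    where
    j≡w : j ≡ w
    j≡w = trans (sym (+-identityʳ j)) j+0≡w
  ∫-countStartingIn-drop B w k≤w (suc n) j j+sn≡w = begin
    ∫ w (λ Q → countStartingIn B (drop j Q) Q)
      ≡⟨ ∫-cong w (λ Q e → countStartingIn-drop B Q Q j (≤-trans j<w (≤-reflexive (sym e)))) ⟩
    ∫ w (λ Q → 𝟙 (isPrefix B (drop j Q ++ Q)) + countStartingIn B (drop (suc j) Q) Q)
      ≡⟨ ∫-+ w _ _ ⟩
    ∫ w (λ Q → 𝟙 (isPrefix B (drop j Q ++ Q))) + ∫ w (λ Q → countStartingIn B (drop (suc j) Q) Q)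
      ≡⟨ cong₂ _+_ (∫-occurrence B w j k≤w (<⇒≤ j<w))
                   (∫-countStartingIn-drop B w k≤w n (suc j) (trans (sym (+-suc j n)) j+sn≡w)) ⟩
    suc n * (mult b B * 2 ^ (b * (w ∸ length B))) ∎
    where
    j<w : j < w
    j<w = ≤-trans (m<m+n j (s≤s z≤n)) (≤-reflexive j+sn≡w)

  ∫-countCyclic : (B : Block b) → ∀ w → length B ≤ w →
    ∫ w (countCyclic B) ≡ w * (mult b B * 2 ^ (b * (w ∸ length B)))
  ∫-countCyclic B w k≤w = ∫-countStartingIn-drop B w k≤w w 0 refl

  allBlocks-length : ∀ w → All (λ Q → length Q ≡ w) (allBlocks b w)
  allBlocks-length zero = refl ∷ []
  allBlocks-length (suc w) =
    concat⁺ (map⁺ (tabulate⁺ {f = λ d → d} (λ d → gmap⁺ {f = d ∷_} (cong suc) (allBlocks-length w))))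

  length-allBlocks : ∀ w → length (allBlocks b w) ≡ suc b ^ w
  length-allBlocks zero = refl
  length-allBlocks (suc w) = begin
    length (concatMap (λ d → map (d ∷_) (allBlocks b w)) (allFin (suc b)))
      ≡⟨ length-concatMap-const (λ d → map (d ∷_) (allBlocks b w)) (suc b ^ w) (allFin (suc b))
           (λ d → trans (length-map (d ∷_) (allBlocks b w)) (length-allBlocks w)) ⟩
    length (allFin (suc b)) * suc b ^ w
      ≡⟨ cong (_* suc b ^ w) (length-tabulate {n = suc b} (λ i → i)) ⟩
    suc b ^ suc w ∎

  sum-allBlocks : ∀ w (φ : Block b → ℕ) → sum (map (λ Q → mult b Q * φ Q) (allBlocks b w)) ≡ ∫ w φ
  sum-allBlocks zero φ = trans (+-identityʳ _) (+-identityʳ (φ []))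
  sum-allBlocks (suc w) φ = begin
    sum (map h (concatMap (λ d → map (d ∷_) (allBlocks b w)) (allFin (suc b))))
      ≡⟨ sum-map-concatMap h (λ d → map (d ∷_) (allBlocks b w)) (allFin (suc b)) ⟩
    sum (map (λ d → sum (map h (map (d ∷_) (allBlocks b w)))) (allFin (suc b)))
      ≡⟨ sum-map-allFin (λ d → sum (map h (map (d ∷_) (allBlocks b w)))) ⟩
    ∑[ d < suc b ] sum (map h (map (d ∷_) (allBlocks b w)))
      ≡⟨ sum-cong-≗ digit ⟩
    ∑[ d < suc b ] (mult b [ d ] * ∫ w (λ Q → φ (d ∷ Q))) ∎
    where
    h : Block b → ℕ
    h Q = mult b Q * φ Q
    digit : ∀ d → sum (map h (map (d ∷_) (allBlocks b w))) ≡ mult b [ d ] * ∫ w (λ Q → φ (d ∷ Q))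
    digit d = begin
      sum (map h (map (d ∷_) (allBlocks b w)))
        ≡⟨ cong sum (map-∘ (allBlocks b w)) ⟨
      sum (map (λ Q → mult b (d ∷ Q) * φ (d ∷ Q)) (allBlocks b w))
        ≡⟨ cong sum (map-cong (λ Q → trans (cong (_* φ (d ∷ Q)) (mult-++ [ d ] Q)) (*-assoc (mult b [ d ]) (mult b Q) _))
                              (allBlocks b w)) ⟩
      sum (map (λ Q → mult b [ d ] * (mult b Q * φ (d ∷ Q))) (allBlocks b w))
        ≡⟨ sum-map-*ˡ (mult b [ d ]) (λ Q → mult b Q * φ (d ∷ Q)) (allBlocks b w) ⟩
      mult b [ d ] * sum (map (λ Q → mult b Q * φ (d ∷ Q)) (allBlocks b w))
        ≡⟨ cong (mult b [ d ] *_) (sum-allBlocks w (φ ∘ (d ∷_))) ⟩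
      mult b [ d ] * ∫ w (λ Q → φ (d ∷ Q)) ∎

lemma4 : (w k b : ℕ) → 1 ≤ w → 1 ≤ k → 1 ≤ b → k ≤ w →
    (B : Block b) → length B ≡ k →
    N B (P b w) ≤ w * (2 ^ b ∸ b) ^ g b B * 2 ^ (b * (w ∸ k)) + (k ∸ 1) * (suc b) ^ w
lemma4 w .(length B) b _ _ _ k≤w B refl =
  ≤-trans (countFrom-runs B (allBlocks b w) (All.map (λ e → ≤-trans k≤w (≤-reflexive (sym e))) (allBlocks-length w)))
          (≤-reflexive (cong₂ _+_ cyclic boundary))
  where
  cyclic : sum (map (λ Q → mult b Q * countCyclic B Q) (allBlocks b w)) ≡ w * mult b B * 2 ^ (b * (w ∸ length B))
  cyclic = trans (sum-allBlocks w (countCyclic B)) (trans (∫-countCyclic B w k≤w) (sym (*-assoc w _ _)))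
  boundary : length (allBlocks b w) * (length B ∸ 1) ≡ (length B ∸ 1) * suc b ^ w
  boundary = trans (cong (_* (length B ∸ 1)) (length-allBlocks w)) (*-comm _ (length B ∸ 1))
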